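{- Let $m\ge1$ and $d\ge2$ be integers with $\gcd(m,d)=1$. For $v\in\mathbb{Z}_m$ let $o(v)$ be the size of the orbit $\{v,dv,d^2v,\dots\}$ of $v$ under the permutation $v\mapsto dv$ of $\mathbb{Z}_m$, and let $\mathcal V$ be a set containing exactly one element from each orbit other than $\{0\}$. Then $\Sigma(m,d)\cong\bigoplus_{v\in\mathcal V}\mathbb{Z}_{d^{o(v)}-1}$.
   Context: In $\mathbb{Q}[x]/(x^m-1)$ (exponents mod $m$) put $e_v=x^v-1$, $\epsilon_v=d\,e_v-e_{dv}$; $\mathcal Z_m$ = $\mathbb{Z}$-span of $e_1,\dots,e_{m-1}$, $\mathcal E_{m,d}$ = $\mathbb{Z}$-span of $\epsilon_1,\dots,\epsilon_{m-1}$, and $\Sigma(m,d)=\mathcal Z_m/\mathcal E_{m,d}$. -}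

module Defs where

open import Data.Bool using (if_then_else_)
open import Data.Nat as ℕ using (ℕ; zero; suc; NonZero; _%_; _<_; _^_; _∸_)
open import Data.Nat.DivMod using (m%n<n)
open import Data.Fin as Fin using (Fin; fromℕ<)
open import Data.Integer as ℤ using (ℤ; +_; _-_; _+_; _*_)
open import Data.Integer.Divisibility using () renaming (_∣_ to _∣ℤ_)
open import Data.List using (List; map; upTo; length; deduplicate; foldr)
open import Data.Product using (Σ; ∃; _×_)
open import Relation.Nullary using (does)
open import Relation.Binary.PropositionalEquality using (_≡_)

-- Elements of ℤ[x]/(x^m - 1) ⊂ ℚ[x]/(x^m - 1) with integer coefficients:
-- p j = coefficient of x^j, j ∈ Fin m.  All of 𝒵_m, ℰ_{m,d} live here.
Poly : ℕ → Set
Poly m = Fin m → ℤ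

sumℤ : List ℤ → ℤ
sumℤ = foldr _+_ (+ 0)

module _ (m : ℕ) {{_ : NonZero m}} where

  idx : ℕ → Fin m
  idx v = fromℕ< (m%n<n v m)

  mono : ℕ → Poly m
  mono v j = if does (j Fin.≟ idx v) then + 1 else + 0

  e : ℕ → Poly m
  e v j = mono v j - mono 0 j

  ε : ℕ → ℕ → Poly m
  ε d v j = + d * e v j - e (d ℕ.* v) j

  nonzeroRes : List ℕ
  nonzeroRes = map suc (upTo (m ∸ 1))

  InZSpan : (ℕ → Poly m) → Poly m → Set
  InZSpan gens p = Σ (ℕ → ℤ) λ c → ∀ j → p j ≡ sumℤ (map (λ v → c v * gens v j) nonzeroRes)

  In𝒵 : Poly m → Set
  In𝒵 = InZSpan e

  Inℰ : ℕ → Poly m → Set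
  Inℰ d = InZSpan (ε d)

  SameOrbit : ℕ → ℕ → ℕ → Set
  SameOrbit d v w = ∃ λ k → (d ^ k ℕ.* v) % m ≡ w % m

  -- o(v) : number of distinct elements of the orbit of v; since the orbit
  -- has at most m elements it is exhausted by d^k v, 0 ≤ k < m.
  orbitSize : ℕ → ℕ → ℕ
  orbitSize d v = length (deduplicate ℕ._≟_ (map (λ k → (d ^ k ℕ.* v) % m) (upTo m)))

  IsTransversal : ℕ → (k : ℕ) → (Fin k → ℕ) → Set
  IsTransversal d k rep =
    (∀ i → 0 < rep i × rep i < m)
    × (∀ i j → SameOrbit d (rep i) (rep j) → i ≡ j)
    × (∀ v → 0 < v → v < m → ∃ λ i → SameOrbit d (rep i) v)

  _+ₚ_ : Poly m → Poly m → Poly m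
  (p +ₚ q) j = p j + q j

  _-ₚ_ : Poly m → Poly m → Poly m
  (p -ₚ q) j = p j - q j

  module _ (d k : ℕ) (rep : Fin k → ℕ) where

    -- equality in ⊕_{v ∈ 𝒱} ℤ_{d^{o(v)} - 1}
    _≈ₜ_ : (Fin k → ℤ) → (Fin k → ℤ) → Set
    t ≈ₜ t' = ∀ i → (+ (d ^ orbitSize d (rep i) ∸ 1)) ∣ℤ (t i - t' i)

    -- φ induces a group isomorphism 𝒵_m / ℰ_{m,d} ≅ ⊕_{v ∈ 𝒱} ℤ_{d^{o(v)} - 1}
    IsIso : (Poly m → Fin k → ℤ) → Set
    IsIso φ =
      (∀ p q → In𝒵 p → In𝒵 q → φ (p +ₚ q) ≈ₜ (λ i → φ p i + φ q i))
      × (∀ p q → In𝒵 p → In𝒵 q → Inℰ d (p -ₚ q) → φ p ≈ₜ φ q)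
      × (∀ p q → In𝒵 p → In𝒵 q → φ p ≈ₜ φ q → Inℰ d (p -ₚ q))
      × (∀ t → ∃ λ p → In𝒵 p × φ p ≈ₜ t)

module Submission where

-- The orbit of r is periodic with exact period P = o(r), so d^a r ≡ d^b r
-- (mod m) iff a ≡ b (mod P).  Hence the weight of the i-th orbit,
-- weight_i(d^t rep_i) = d^(t mod P), and weight_i = 0 off the orbit, is well
-- defined, and since d^a ≡ d^b (mod d^P - 1) whenever a ≡ b (mod P) it satisfies
-- weight_i(d v) ≡ d·weight_i(v).  The coordinates φ(p)_i = Σ_j p_j weight_i(j) are
-- additive, send e_v to weight_i(v) and ε_v to d·weight_i(v) - weight_i(d v) ≡ 0,
-- so φ is well defined on Σ(m,d); φ(Σ_i t_i e_{rep i}) = t gives surjectivity.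
-- For injectivity, telescoping the ε's shows e_v ≡ d^(t mod P) e_{rep i} (mod ℰ)
-- when v ≡ d^t rep_i, and (d^P - 1) e_{rep i} ∈ ℰ; so every p ∈ 𝒵 is congruent to
-- its normal form Σ_i φ(p)_i e_{rep i}, which lies in ℰ as soon as φ(p) ≡ 0.

open import Defs
open import Data.Nat as ℕ using (ℕ; zero; suc; NonZero; _≤_; _<_; z≤n; s≤s; _%_; _/_; _^_)
open import Data.Nat.DivMod using (m%n<n; m%n%n≡m%n; m<n⇒m%n≡m; m≡m%n+[m/n]*n; %-distribˡ-*; [m+n]%n≡m%n; [m+kn]%n≡m%n)
import Data.Nat.GCD as GCD
import Data.Nat.Properties as ℕP
open import Data.Nat.Coprimality using (Coprime; coprime-Bézout)
import Data.Nat.Tactic.RingSolver as ℕSolver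
open import Data.Integer as ℤ using (ℤ; +_; -_; _+_; _-_; _*_)
import Data.Integer.Properties as ℤP
open import Data.Integer.Divisibility.Signed
  using (_∣_; divides; ∣m∣n⇒∣m+n; ∣m∣n⇒∣m-n; ∣n⇒∣m*n; ∣⇒∣ᵤ; ∣ᵤ⇒∣)
open import Data.Integer.Divisibility using () renaming (_∣_ to _∣ᵤ_)
open import Data.Integer.Tactic.RingSolver using (solve-∀)
open import Data.Fin as Fin using (Fin; toℕ; fromℕ<)
import Data.Fin.Properties as FinP
open import Data.Product using (Σ; ∃; _×_; _,_; proj₁; proj₂)
open import Data.Sum using (_⊎_; inj₁; inj₂)
open import Relation.Binary.Definitions using (tri<; tri≈; tri>)
open import Data.List using (List; map; applyUpTo; upTo; tabulate; deduplicate; length)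
open import Data.List.Properties using (map-applyUpTo; length-tabulate)
open import Data.List.Membership.Propositional.Properties
  using (∈-map⁺; ∈-map⁻; ∈-upTo⁺; ∈-tabulate⁺; ∈-tabulate⁻; ∈-deduplicate⁺; ∈-deduplicate⁻)
open import Data.List.Membership.Propositional.Properties.WithK using (unique∧set⇒bag)
open import Data.List.Relation.Unary.Unique.Propositional using (Unique)
open import Data.List.Relation.Unary.Unique.Propositional.Properties using (tabulate⁺)
open import Data.List.Relation.Unary.Unique.DecPropositional.Properties ℕ._≟_ using (deduplicate-!)
open import Data.List.Relation.Binary.BagAndSetEquality using (∼bag⇒↭)
open import Data.List.Relation.Binary.Permutation.Propositional.Properties using (↭-length)
open import Function.Bundles using (mk⇔)
open import Function using (_∘_; case_of_)
open import Relation.Nullary using (¬_; Dec; yes; no; does; contradiction)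
open import Relation.Nullary.Decidable using (dec-true; dec-false)
open import Data.Bool using (if_then_else_)
open import Data.Vec.Functional using ([]; _∷_)
open import Relation.Binary.PropositionalEquality

open import Algebra.Properties.Semiring.Sum ℤP.+-*-semiring
  using (sum; sum-syntax; sum-cong-≗; sum-replicate-zero; sum-remove;
         ∑-distrib-+; ∑-comm; *-distribˡ-sum; *-distribʳ-sum)

sum-single : ∀ {n} (f : Fin n → ℤ) (i₀ : Fin n) →
             (∀ i → i ≢ i₀ → f i ≡ + 0) → sum f ≡ f i₀
sum-single {suc n} f i₀ vanish = begin
  sum f                         ≡⟨ sum-remove {i = i₀} f ⟩
  f i₀ + sum (f ∘ Fin.punchIn i₀) ≡⟨ cong (λ s → f i₀ + s) rest≡0 ⟩
  f i₀ + + 0                    ≡⟨ ℤP.+-identityʳ (f i₀) ⟩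
  f i₀                          ∎
  where
  open ≡-Reasoning
  rest≡0 : sum (f ∘ Fin.punchIn i₀) ≡ + 0
  rest≡0 = trans (sum-cong-≗ (λ j → vanish _ (FinP.punchInᵢ≢i i₀ j)))
                 (sum-replicate-zero n)

∣-sum : ∀ {n N} (f : Fin n → ℤ) → (∀ i → N ∣ f i) → N ∣ sum f
∣-sum {zero}  {N} f _   = divides (+ 0) (sym (ℤP.*-zeroˡ N))
∣-sum {suc n}     f div = ∣m∣n⇒∣m+n (div Fin.zero) (∣-sum (f ∘ Fin.suc) (div ∘ Fin.suc))

∑-sub : ∀ {n} (f g : Fin n → ℤ) → ∑[ i < n ] (f i - g i) ≡ sum f - sum g
∑-sub {zero}  f g = refl
∑-sub {suc n} f g = trans (cong (λ s → (f Fin.zero - g Fin.zero) + s) (∑-sub (f ∘ Fin.suc) (g ∘ Fin.suc)))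
                          (regroup (f Fin.zero) (g Fin.zero) (sum (f ∘ Fin.suc)) (sum (g ∘ Fin.suc)))
  where
  regroup : ∀ a b x y → a - b + (x - y) ≡ a + x - (b + y)
  regroup = solve-∀

sumℤ-applyUpTo : ∀ (f : ℕ → ℤ) (g : ℕ → ℕ) n →
                 sumℤ (map f (applyUpTo g n)) ≡ ∑[ i < n ] f (g (toℕ i))
sumℤ-applyUpTo f g zero    = refl
sumℤ-applyUpTo f g (suc n) = cong (λ s → f (g 0) + s) (sumℤ-applyUpTo f (g ∘ suc) n)

⟦_⟧ : ∀ {P : Set} → Dec P → ℤ
⟦ P? ⟧ = if does P? then + 1 else + 0

⟦⟧-yes : ∀ {P : Set} (P? : Dec P) → P → ⟦ P? ⟧ ≡ + 1
⟦⟧-yes P? p rewrite dec-true P? p = refl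

⟦⟧-no : ∀ {P : Set} (P? : Dec P) → ¬ P → ⟦ P? ⟧ ≡ + 0
⟦⟧-no P? ¬p rewrite dec-false P? ¬p = refl

sum-select : ∀ {n} (f : Fin n → ℤ) (i₀ : Fin n) →
             ∑[ i < n ] (⟦ i Fin.≟ i₀ ⟧ * f i) ≡ f i₀
sum-select f i₀ = trans (sum-single _ i₀ off) on
  where
  off : ∀ i → i ≢ i₀ → ⟦ i Fin.≟ i₀ ⟧ * f i ≡ + 0
  off i i≢i₀ rewrite ⟦⟧-no (i Fin.≟ i₀) i≢i₀ = ℤP.*-zeroˡ (f i)
  on : ⟦ i₀ Fin.≟ i₀ ⟧ * f i₀ ≡ f i₀
  on rewrite ⟦⟧-yes (i₀ Fin.≟ i₀) refl = ℤP.*-identityˡ (f i₀)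

sum-lincomb : ∀ {n k} (a : Fin n → ℤ) (F : Fin n → Fin k → ℤ) (w : Fin k → ℤ) →
              ∑[ j < k ] (∑[ i < n ] (a i * F i j) * w j) ≡ ∑[ i < n ] (a i * ∑[ j < k ] (F i j * w j))
sum-lincomb {n} {k} a F w = begin
  ∑[ j < k ] (∑[ i < n ] (a i * F i j) * w j)   ≡⟨ sum-cong-≗ (λ j → *-distribʳ-sum (w j) (λ i → a i * F i j)) ⟩
  ∑[ j < k ] ∑[ i < n ] (a i * F i j * w j)     ≡⟨ ∑-comm (λ j i → a i * F i j * w j) ⟩
  ∑[ i < n ] ∑[ j < k ] (a i * F i j * w j)     ≡⟨ sum-cong-≗ (λ i → sum-cong-≗ (λ j → ℤP.*-assoc (a i) (F i j) (w j))) ⟩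
  ∑[ i < n ] ∑[ j < k ] (a i * (F i j * w j))   ≡⟨ sum-cong-≗ (λ i → sym (*-distribˡ-sum (a i) (λ j → F i j * w j))) ⟩
  ∑[ i < n ] (a i * ∑[ j < k ] (F i j * w j))   ∎
  where open ≡-Reasoning

module Congruence (m' : ℕ) where

  private
    M : ℕ
    M = suc m'

  infix 4 _≈_
  _≈_ : ℕ → ℕ → Set
  x ≈ y = x % M ≡ y % M

  ≈-mulˡ : ∀ a {x y} → x ≈ y → a ℕ.* x ≈ a ℕ.* y
  ≈-mulˡ a {x} {y} x≈y = begin
    (a ℕ.* x) % M                ≡⟨ %-distribˡ-* a x M ⟩
    ((a % M) ℕ.* (x % M)) % M    ≡⟨ cong (λ z → ((a % M) ℕ.* z) % M) x≈y ⟩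
    ((a % M) ℕ.* (y % M)) % M    ≡⟨ %-distribˡ-* a y M ⟨
    (a ℕ.* y) % M                ∎
    where open ≡-Reasoning

  ≈-mulʳ : ∀ a {x y} → x ≈ y → x ℕ.* a ≈ y ℕ.* a
  ≈-mulʳ a {x} {y} x≈y rewrite ℕP.*-comm x a | ℕP.*-comm y a = ≈-mulˡ a x≈y

  -- A number d coprime to M is a unit modulo M (Bézout), so d and its powers
  -- may be cancelled in congruences.
  module Unit (d : ℕ) (cop : Coprime M d) where

    inverse : ∃ λ u → u ℕ.* d ≈ 1
    inverse with coprime-Bézout cop
    ... | GCD.Bézout.-+ x y eq = y , (begin
      (y ℕ.* d) % M          ≡⟨ cong (_% M) eq ⟨
      (1 ℕ.+ x ℕ.* M) % M    ≡⟨ [m+kn]%n≡m%n 1 x M ⟩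
      1 % M                  ∎)
      where open ≡-Reasoning
    ... | GCD.Bézout.+- x y eq = y ℕ.* m' , (begin
      (y ℕ.* m' ℕ.* d) % M                  ≡⟨ [m+kn]%n≡m%n (y ℕ.* m' ℕ.* d) x M ⟨
      (y ℕ.* m' ℕ.* d ℕ.+ x ℕ.* M) % M      ≡⟨ cong (_% M) rearrange ⟩
      (1 ℕ.+ (d ℕ.* y) ℕ.* M) % M           ≡⟨ [m+kn]%n≡m%n 1 (d ℕ.* y) M ⟩
      1 % M                                 ∎)
      where
      open ≡-Reasoning
      identity : ∀ y m' d → y ℕ.* m' ℕ.* d ℕ.+ (1 ℕ.+ y ℕ.* d) ≡ 1 ℕ.+ (d ℕ.* y) ℕ.* suc m'
      identity = ℕSolver.solve-∀
      rearrange : y ℕ.* m' ℕ.* d ℕ.+ x ℕ.* M ≡ 1 ℕ.+ (d ℕ.* y) ℕ.* M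
      rearrange = trans (cong (y ℕ.* m' ℕ.* d ℕ.+_) (sym eq)) (identity y m' d)

    cancel : ∀ {x y} → d ℕ.* x ≈ d ℕ.* y → x ≈ y
    cancel {x} {y} dx≈dy = begin
      x % M                    ≡⟨ cong (_% M) (ℕP.*-identityˡ x) ⟨
      (1 ℕ.* x) % M            ≡⟨ ≈-mulʳ x {u ℕ.* d} {1} ud≈1 ⟨
      (u ℕ.* d ℕ.* x) % M      ≡⟨ cong (_% M) (ℕP.*-assoc u d x) ⟩
      (u ℕ.* (d ℕ.* x)) % M    ≡⟨ ≈-mulˡ u {d ℕ.* x} {d ℕ.* y} dx≈dy ⟩
      (u ℕ.* (d ℕ.* y)) % M    ≡⟨ cong (_% M) (ℕP.*-assoc u d y) ⟨
      (u ℕ.* d ℕ.* y) % M      ≡⟨ ≈-mulʳ y {u ℕ.* d} {1} ud≈1 ⟩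
      (1 ℕ.* y) % M            ≡⟨ cong (_% M) (ℕP.*-identityˡ y) ⟩
      y % M                    ∎
      where
      open ≡-Reasoning
      u = proj₁ inverse
      ud≈1 = proj₂ inverse

    cancel-pow : ∀ a {x y} → d ^ a ℕ.* x ≈ d ^ a ℕ.* y → x ≈ y
    cancel-pow zero {x} {y} eq
      rewrite ℕP.*-identityˡ x | ℕP.*-identityˡ y = eq
    cancel-pow (suc a) {x} {y} eq
      rewrite ℕP.*-assoc d (d ^ a) x | ℕP.*-assoc d (d ^ a) y = cancel-pow a (cancel eq)

module Polynomials (m' : ℕ) where

  private
    M : ℕ
    M = suc m'

  ∑⁺ : (ℕ → ℤ) → ℤ
  ∑⁺ f = ∑[ i < m' ] f (suc (toℕ i))

  sumℤ-nonzeroRes : ∀ f → sumℤ (map f (nonzeroRes M)) ≡ ∑⁺ f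
  sumℤ-nonzeroRes f = trans (cong (sumℤ ∘ map f) (map-applyUpTo (λ v → v) suc m'))
                            (sumℤ-applyUpTo f suc m')

  ⟨_,_⟩ : Poly M → (Fin M → ℤ) → ℤ
  ⟨ p , w ⟩ = ∑[ j < M ] (p j * w j)

  pair-resp : ∀ {p q} w → p ≗ q → ⟨ p , w ⟩ ≡ ⟨ q , w ⟩
  pair-resp w p≗q = sum-cong-≗ (λ j → cong (_* w j) (p≗q j))

  pair-+ : ∀ p q w → ⟨ _+ₚ_ M p q , w ⟩ ≡ ⟨ p , w ⟩ + ⟨ q , w ⟩
  pair-+ p q w = trans (sum-cong-≗ (λ j → ℤP.*-distribʳ-+ (w j) (p j) (q j)))
                       (∑-distrib-+ (λ j → p j * w j) (λ j → q j * w j))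

  pair-sub : ∀ p q w → ⟨ (λ j → p j - q j) , w ⟩ ≡ ⟨ p , w ⟩ - ⟨ q , w ⟩
  pair-sub p q w = trans (sum-cong-≗ (λ j → distrib (p j) (q j) (w j)))
                         (∑-sub (λ j → p j * w j) (λ j → q j * w j))
    where
    distrib : ∀ x y z → (x - y) * z ≡ x * z - y * z
    distrib = solve-∀

  pair-scale : ∀ c p w → ⟨ (λ j → c * p j) , w ⟩ ≡ c * ⟨ p , w ⟩
  pair-scale c p w = trans (sum-cong-≗ (λ j → ℤP.*-assoc c (p j) (w j)))
                           (sym (*-distribˡ-sum c (λ j → p j * w j)))

  pair-mono : ∀ v w → ⟨ mono M v , w ⟩ ≡ w (idx M v)
  pair-mono v w = sum-select w (idx M v)

  pair-e : ∀ v w → ⟨ e M v , w ⟩ ≡ w (idx M v) - w (idx M 0)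
  pair-e v w = trans (pair-sub (mono M v) (mono M 0) w) (cong₂ _-_ (pair-mono v w) (pair-mono 0 w))

  open Congruence m'

  idx-≈ : ∀ {x y} → x ≈ y → idx M x ≡ idx M y
  idx-≈ {x} {y} x≈y = FinP.toℕ-injective
    (trans (FinP.toℕ-fromℕ< (m%n<n x M)) (trans x≈y (sym (FinP.toℕ-fromℕ< (m%n<n y M)))))

  e-resp : ∀ {x y} → x ≈ y → e M x ≗ e M y
  e-resp {x} {y} x≈y j = cong (λ a → ⟦ j Fin.≟ a ⟧ - mono M 0 j) (idx-≈ {x} {y} x≈y)

  e-0 : e M 0 ≗ (λ _ → + 0)
  e-0 j = ℤP.i≡j⇒i-j≡0 {mono M 0 j} refl

  module _ (g : ℕ → Poly M) where

    span-intro : ∀ {p} (c : ℕ → ℤ) → (∀ j → p j ≡ ∑⁺ (λ v → c v * g v j)) → InZSpan M g p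
    span-intro c eq = c , λ j → trans (eq j) (sym (sumℤ-nonzeroRes _))

    span-elim : ∀ {p} (s : InZSpan M g p) → ∀ j → p j ≡ ∑⁺ (λ v → proj₁ s v * g v j)
    span-elim (c , eq) j = trans (eq j) (sumℤ-nonzeroRes _)

    span-resp : ∀ {p q} → p ≗ q → InZSpan M g p → InZSpan M g q
    span-resp p≗q (c , eq) = c , λ j → trans (sym (p≗q j)) (eq j)

    span-lincomb : ∀ {n} (a : Fin n → ℤ) (F : Fin n → Poly M) → (∀ i → InZSpan M g (F i)) →
                   InZSpan M g (λ j → ∑[ i < n ] (a i * F i j))
    span-lincomb {n} a F s = span-intro (λ v → ∑[ i < n ] (a i * coeff i v)) λ j → begin
      ∑[ i < n ] (a i * F i j)
        ≡⟨ sum-cong-≗ (λ i → cong (a i *_) (span-elim (s i) j)) ⟩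
      ∑[ i < n ] (a i * ∑⁺ (λ v → coeff i v * g v j))
        ≡⟨ sym (sum-lincomb {k = m'} a (λ i t → coeff i (suc (toℕ t))) (λ t → g (suc (toℕ t)) j)) ⟩
      ∑⁺ (λ v → ∑[ i < n ] (a i * coeff i v) * g v j)
        ∎
      where
      open ≡-Reasoning
      coeff : Fin n → ℕ → ℤ
      coeff i = proj₁ (s i)

    span-zero : InZSpan M g (λ _ → + 0)
    span-zero = span-lincomb {0} (λ ()) (λ ()) (λ ())

    span-+ : ∀ {p q} → InZSpan M g p → InZSpan M g q → InZSpan M g (λ j → p j + q j)
    span-+ {p} {q} sp sq =
      span-resp (λ j → sum₂ (p j) (q j)) (span-lincomb (+ 1 ∷ + 1 ∷ []) (p ∷ q ∷ []) λ
        { Fin.zero → sp ; (Fin.suc Fin.zero) → sq })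
      where
      sum₂ : ∀ x y → + 1 * x + (+ 1 * y + + 0) ≡ x + y
      sum₂ = solve-∀

    span-sub : ∀ {p q} → InZSpan M g p → InZSpan M g q → InZSpan M g (λ j → p j - q j)
    span-sub {p} {q} sp sq =
      span-resp (λ j → difference (p j) (q j)) (span-lincomb (+ 1 ∷ - + 1 ∷ []) (p ∷ q ∷ []) λ
        { Fin.zero → sp ; (Fin.suc Fin.zero) → sq })
      where
      difference : ∀ x y → + 1 * x + (- + 1 * y + + 0) ≡ x - y
      difference = solve-∀

    span-scale : ∀ a {p} → InZSpan M g p → InZSpan M g (λ j → a * p j)
    span-scale a {p} sp =
      span-resp (λ j → ℤP.+-identityʳ (a * p j)) (span-lincomb (a ∷ []) (p ∷ []) λ { Fin.zero → sp })

    span-gen : ∀ v → 0 < v → v < M → InZSpan M g (g v)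
    span-gen (suc u) _ (s≤s u<m') = span-intro (λ v → ⟦ v ℕ.≟ suc u ⟧) λ j →
      sym (trans (sum-single _ i₀ (off j)) (on j))
      where
      i₀ : Fin m'
      i₀ = fromℕ< u<m'
      sameIndex : ∀ i → suc (toℕ i) ≡ suc u → i ≡ i₀
      sameIndex i eq = FinP.toℕ-injective (trans (ℕP.suc-injective eq) (sym (FinP.toℕ-fromℕ< u<m')))
      off : ∀ j i → i ≢ i₀ → ⟦ suc (toℕ i) ℕ.≟ suc u ⟧ * g (suc (toℕ i)) j ≡ + 0
      off j i i≢i₀ rewrite ⟦⟧-no (suc (toℕ i) ℕ.≟ suc u) (i≢i₀ ∘ sameIndex i) =
        ℤP.*-zeroˡ (g (suc (toℕ i)) j)
      on : ∀ j → ⟦ suc (toℕ i₀) ℕ.≟ suc u ⟧ * g (suc (toℕ i₀)) j ≡ g (suc u) j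
      on j rewrite FinP.toℕ-fromℕ< u<m' | ⟦⟧-yes (suc u ℕ.≟ suc u) refl = ℤP.*-identityˡ (g (suc u) j)

pred∣pow-pred : ∀ X q → (+ X - + 1) ∣ (+ (X ^ q) - + 1)
pred∣pow-pred X zero    = divides (+ 0) (sym (ℤP.*-zeroˡ (+ X - + 1)))
pred∣pow-pred X (suc q) = subst ((+ X - + 1) ∣_) (sym split)
  (∣m∣n⇒∣m+n (∣n⇒∣m*n (+ X) (pred∣pow-pred X q)) (divides (+ 1) (sym (ℤP.*-identityˡ _))))
  where
  step : ∀ x y → x * y - + 1 ≡ x * (y - + 1) + (x - + 1)
  step = solve-∀
  split : + (X ^ suc q) - + 1 ≡ + X * (+ (X ^ q) - + 1) + (+ X - + 1)
  split = trans (cong (_- + 1) (ℤP.pos-* X (X ^ q))) (step (+ X) (+ (X ^ q)))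

pow-divmod : ∀ d P .{{_ : NonZero P}} a → d ^ a ≡ d ^ (a % P) ℕ.* (d ^ P) ^ (a / P)
pow-divmod d P a = begin
  d ^ a                                ≡⟨ cong (d ^_) (m≡m%n+[m/n]*n a P) ⟩
  d ^ (a % P ℕ.+ a / P ℕ.* P)          ≡⟨ ℕP.^-distribˡ-+-* d (a % P) (a / P ℕ.* P) ⟩
  d ^ (a % P) ℕ.* d ^ (a / P ℕ.* P)    ≡⟨ cong (λ z → d ^ (a % P) ℕ.* d ^ z) (ℕP.*-comm (a / P) P) ⟩
  d ^ (a % P) ℕ.* d ^ (P ℕ.* (a / P))  ≡⟨ cong (d ^ (a % P) ℕ.*_) (sym (ℕP.^-*-assoc d P (a / P))) ⟩
  d ^ (a % P) ℕ.* (d ^ P) ^ (a / P)    ∎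
  where open ≡-Reasoning

pow-congruence : ∀ d P .{{_ : NonZero P}} a b → a % P ≡ b % P →
                 (+ (d ^ P) - + 1) ∣ (+ (d ^ a) - + (d ^ b))
pow-congruence d P a b a≡b = subst ((+ (d ^ P) - + 1) ∣_) (sym split)
  (∣m∣n⇒∣m-n (∣n⇒∣m*n (+ (d ^ c)) (pred∣pow-pred X (a / P)))
             (∣n⇒∣m*n (+ (d ^ c)) (pred∣pow-pred X (b / P))))
  where
  open ≡-Reasoning
  X = d ^ P
  c = a % P
  factor : ∀ x y z → x * y - x * z ≡ x * (y - + 1) - x * (z - + 1)
  factor = solve-∀
  split : + (d ^ a) - + (d ^ b) ≡ + (d ^ c) * (+ (X ^ (a / P)) - + 1) - + (d ^ c) * (+ (X ^ (b / P)) - + 1)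
  split = begin
    + (d ^ a) - + (d ^ b)
      ≡⟨ cong₂ (λ u v → + u - + v) (pow-divmod d P a)
               (trans (pow-divmod d P b) (cong (λ z → d ^ z ℕ.* X ^ (b / P)) (sym a≡b))) ⟩
    + (d ^ c ℕ.* X ^ (a / P)) - + (d ^ c ℕ.* X ^ (b / P))
      ≡⟨ cong₂ _-_ (ℤP.pos-* (d ^ c) _) (ℤP.pos-* (d ^ c) _) ⟩
    + (d ^ c) * + (X ^ (a / P)) - + (d ^ c) * + (X ^ (b / P))
      ≡⟨ factor (+ (d ^ c)) (+ (X ^ (a / P))) (+ (X ^ (b / P))) ⟩
    + (d ^ c) * (+ (X ^ (a / P)) - + 1) - + (d ^ c) * (+ (X ^ (b / P)) - + 1)
      ∎

module LeastNumber {Q : ℕ → Set} (Q? : ∀ n → Dec (Q n)) where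

  search : ∀ n → (∀ j → j < n → ¬ Q j) ⊎ (∃ λ k → Q k × k < n × (∀ j → j < k → ¬ Q j))
  search zero = inj₁ (λ j ())
  search (suc n) with search n
  ... | inj₂ (k , q , k<n , below) = inj₂ (k , q , ℕP.m<n⇒m<1+n k<n , below)
  ... | inj₁ none with Q? n
  ...   | yes q  = inj₂ (n , q , ℕP.n<1+n n , none)
  ...   | no ¬q  = inj₁ λ j j<1+n → case ℕP.m<1+n⇒m<n∨m≡n j<1+n of λ
    { (inj₁ j<n) → none j j<n
    ; (inj₂ refl) → ¬q }

  least : ∀ n → Q n → ∃ λ k → Q k × k ≤ n × (∀ j → j < k → ¬ Q j)
  least n q with search (suc n)
  ... | inj₁ none                     = contradiction q (none n (ℕP.n<1+n n))
  ... | inj₂ (k , qk , k<1+n , below) = k , qk , ℕ.s≤s⁻¹ k<1+n , below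

module Orbit (m' d : ℕ) (cop : Coprime (suc m') d) (r : ℕ) where

  open Congruence m'
  open Unit d cop

  private
    M : ℕ
    M = suc m'

  T : ℕ → ℕ
  T k = d ^ k ℕ.* r

  T-add : ∀ a b → T (a ℕ.+ b) ≡ d ^ a ℕ.* T b
  T-add a b rewrite ℕP.^-distribˡ-+-* d a b = ℕP.*-assoc (d ^ a) (d ^ b) r

  T-0 : T 0 ≡ r
  T-0 = ℕP.*-identityˡ r

  T-scale : ∀ a → T a ≡ d ^ a ℕ.* T 0
  T-scale a = cong (d ^ a ℕ.*_) (sym T-0)

  T-suc : ∀ t → T (suc t) ≡ d ℕ.* T t
  T-suc t = ℕP.*-assoc d (d ^ t) r

  -- A repetition T a ≈ T b with a < b is a return to r after b - a steps
  -- (cancel d^a, which is a unit).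
  repetition : ∀ {a b} → a < b → T a ≈ T b → ∃ λ c → b ≡ a ℕ.+ suc c × T (suc c) ≈ T 0
  repetition {a} {b} a<b Ta≈Tb = c , b≡a+1+c , sym (cancel-pow a shifted)
    where
    c = b ℕ.∸ suc a
    b≡a+1+c : b ≡ a ℕ.+ suc c
    b≡a+1+c = trans (sym (ℕP.m∸n+n≡m a<b)) (trans (ℕP.+-comm c (suc a)) (sym (ℕP.+-suc a c)))
    shifted : d ^ a ℕ.* T 0 ≈ d ^ a ℕ.* T (suc c)
    shifted = subst₂ _≈_ (T-scale a) (trans (cong T b≡a+1+c) (T-add a (suc c))) Ta≈Tb

  residue : ℕ → Fin M
  residue a = fromℕ< (m%n<n (T a) M)

  residue-≡ : ∀ {a b} → residue a ≡ residue b → T a ≈ T b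
  residue-≡ {a} {b} eq = trans (sym (FinP.toℕ-fromℕ< (m%n<n (T a) M)))
                           (trans (cong toℕ eq) (FinP.toℕ-fromℕ< (m%n<n (T b) M)))

  -- The search for the first return is kept opaque: only its specification
  -- matters, and unfolding it would make Agda evaluate the search.
  opaque
    -- By pigeonhole among T 0, …, T M, the orbit returns to r within M steps.
    returns : ∃ λ c → T (suc c) ≈ T 0 × suc c ≤ M
    returns with FinP.pigeonhole (ℕP.n<1+n M) (residue ∘ toℕ)
    ... | i , j , i<j , same with repetition {toℕ i} {toℕ j} i<j (residue-≡ {toℕ i} {toℕ j} same)
    ...   | c , j≡ , ret = c , ret , ℕ.s≤s⁻¹ (ℕP.≤-trans (s≤s (ℕP.m≤n+m (suc c) (toℕ i)))
                                                       (subst (_< suc M) j≡ (FinP.toℕ<n j)))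

    firstReturn : ∃ λ c → T (suc c) ≈ T 0 × c ≤ proj₁ returns × (∀ j → j < c → ¬ T (suc j) ≈ T 0)
    firstReturn = LeastNumber.least (λ c → T (suc c) % M ℕ.≟ T 0 % M) (proj₁ returns) (proj₁ (proj₂ returns))

  -- The period: the least P ≥ 1 with d^P r ≡ r (mod M).
  P : ℕ
  P = suc (proj₁ firstReturn)

  P-returns : T P ≈ T 0
  P-returns = proj₁ (proj₂ firstReturn)

  P≤M : P ≤ M
  P≤M = ℕP.≤-trans (s≤s (proj₁ (proj₂ (proj₂ firstReturn)))) (proj₂ (proj₂ returns))

  no-early-return : ∀ {a b} → a < b → b < P → ¬ T a ≈ T b
  no-early-return {a} a<b b<P Ta≈Tb with repetition a<b Ta≈Tb
  ... | c , b≡ , ret = proj₂ (proj₂ (proj₂ firstReturn)) c c<c₀ ret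
    where
    c<c₀ : c < proj₁ firstReturn
    c<c₀ = ℕ.s≤s⁻¹ (ℕP.≤-trans (s≤s (s≤s (ℕP.m≤n+m c a)))
                                (ℕP.≤-trans (ℕP.≤-reflexive (cong suc (trans (sym (ℕP.+-suc a c)) (sym b≡)))) b<P))

  distinct : ∀ {a b} → a < P → b < P → T a ≈ T b → a ≡ b
  distinct {a} {b} a<P b<P Ta≈Tb with ℕP.<-cmp a b
  ... | tri< a<b _ _ = contradiction Ta≈Tb (no-early-return a<b b<P)
  ... | tri≈ _ a≡b _ = a≡b
  ... | tri> _ _ b<a = contradiction (sym Ta≈Tb) (no-early-return b<a a<P)

  P-multiple : ∀ q → T (q ℕ.* P) ≈ T 0
  P-multiple zero    = refl
  P-multiple (suc q) = begin
    T (P ℕ.+ q ℕ.* P) % M       ≡⟨ cong (_% M) (T-add P (q ℕ.* P)) ⟩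
    (d ^ P ℕ.* T (q ℕ.* P)) % M ≡⟨ ≈-mulˡ (d ^ P) (P-multiple q) ⟩
    (d ^ P ℕ.* T 0) % M         ≡⟨ cong (_% M) (T-scale P) ⟨
    T P % M                     ≡⟨ P-returns ⟩
    T 0 % M                     ∎
    where open ≡-Reasoning

  reduce : ∀ k → T k ≈ T (k % P)
  reduce k = begin
    T k % M                                   ≡⟨ cong (λ z → T z % M) (m≡m%n+[m/n]*n k P) ⟩
    T (k % P ℕ.+ k / P ℕ.* P) % M             ≡⟨ cong (_% M) (T-add (k % P) (k / P ℕ.* P)) ⟩
    (d ^ (k % P) ℕ.* T (k / P ℕ.* P)) % M     ≡⟨ ≈-mulˡ (d ^ (k % P)) (P-multiple (k / P)) ⟩
    (d ^ (k % P) ℕ.* T 0) % M                 ≡⟨ cong (_% M) (T-scale (k % P)) ⟨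
    T (k % P) % M                             ∎
    where open ≡-Reasoning

  ≡%⇒≈ : ∀ {a b} → a % P ≡ b % P → T a ≈ T b
  ≡%⇒≈ {a} {b} eq = trans (reduce a) (trans (cong (λ z → T z % M) eq) (sym (reduce b)))

  ≈⇒≡% : ∀ {a b} → T a ≈ T b → a % P ≡ b % P
  ≈⇒≡% {a} {b} eq = distinct (m%n<n a P) (m%n<n b P) (trans (sym (reduce a)) (trans eq (reduce b)))

  orbitSize≡P : orbitSize M d r ≡ P
  orbitSize≡P = begin
    length (deduplicate ℕ._≟_ visited) ≡⟨ ↭-length (∼bag⇒↭ (unique∧set⇒bag (deduplicate-! visited) cycle-unique
                                                         (mk⇔ visited⇒cycle cycle⇒visited))) ⟩
    length cycle                      ≡⟨ length-tabulate cycleAt ⟩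
    P                                 ∎
    where
    open ≡-Reasoning
    open import Data.List.Membership.Propositional using (_∈_)
    visited : List ℕ
    visited = map (λ k → T k % M) (upTo M)
    cycleAt : Fin P → ℕ
    cycleAt i = T (toℕ i) % M
    cycle : List ℕ
    cycle = tabulate cycleAt
    cycle-unique : Unique cycle
    cycle-unique = tabulate⁺ {f = cycleAt} λ {i} {j} eq →
      FinP.toℕ-injective (distinct (FinP.toℕ<n i) (FinP.toℕ<n j) eq)
    visited⇒cycle : ∀ {x} → x ∈ deduplicate ℕ._≟_ visited → x ∈ cycle
    visited⇒cycle x∈ with ∈-map⁻ (λ k → T k % M) {xs = upTo M} (∈-deduplicate⁻ ℕ._≟_ visited x∈)
    ... | k , _ , refl = subst (_∈ cycle) same (∈-tabulate⁺ {f = cycleAt} (fromℕ< (m%n<n k P)))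
      where
      same : cycleAt (fromℕ< (m%n<n k P)) ≡ T k % M
      same = trans (cong (λ z → T z % M) (FinP.toℕ-fromℕ< (m%n<n k P))) (sym (reduce k))
    cycle⇒visited : ∀ {x} → x ∈ cycle → x ∈ deduplicate ℕ._≟_ visited
    cycle⇒visited x∈ with ∈-tabulate⁻ {f = cycleAt} x∈
    ... | i , refl = ∈-deduplicate⁺ ℕ._≟_ (∈-map⁺ (λ k → T k % M) (∈-upTo⁺ (ℕP.≤-trans (FinP.toℕ<n i) P≤M)))

  orbit-back : ∀ {x} k → T k ≈ x → ∃ λ k' → d ^ k' ℕ.* x ≈ r
  orbit-back {x} k Tk≈x = c₀ ℕ.* k , (begin
    (d ^ (c₀ ℕ.* k) ℕ.* x) % M       ≡⟨ ≈-mulˡ (d ^ (c₀ ℕ.* k)) Tk≈x ⟨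
    (d ^ (c₀ ℕ.* k) ℕ.* T k) % M     ≡⟨ cong (_% M) (T-add (c₀ ℕ.* k) k) ⟨
    T (c₀ ℕ.* k ℕ.+ k) % M           ≡⟨ cong (λ z → T z % M) exponent ⟩
    T (k ℕ.* P) % M                  ≡⟨ P-multiple k ⟩
    T 0 % M                          ≡⟨ cong (_% M) T-0 ⟩
    r % M                            ∎)
    where
    open ≡-Reasoning
    c₀ = proj₁ firstReturn
    exponent : c₀ ℕ.* k ℕ.+ k ≡ k ℕ.* P
    exponent = trans (ℕP.+-comm (c₀ ℕ.* k) k)
                     (trans (cong (k ℕ.+_) (ℕP.*-comm c₀ k)) (sym (ℕP.*-suc k c₀)))

  -- Membership in the orbit (Defs.SameOrbit) is decidable: it suffices to
  -- inspect T 0, …, T (P-1).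
  inOrbit? : ∀ x → Dec (SameOrbit M d r x)
  inOrbit? x with ℕP.anyUpTo? (λ t → T t % M ℕ.≟ x % M) P
  ... | yes (t , _ , Tt≈x) = yes (t , Tt≈x)
  ... | no none            = no λ (t , Tt≈x) → none (t % P , m%n<n t P , trans (sym (reduce t)) Tt≈x)

  -- The weight of x: d^(t mod P) if x ≡ d^t r (mod M), and 0 off the orbit.
  -- It is well defined because t mod P is determined by x.
  weight : ℕ → ℤ
  weight x with inOrbit? x
  ... | yes (t , _) = + (d ^ (t % P))
  ... | no _        = + 0

  weight-orbit : ∀ {x} t → T t ≈ x → weight x ≡ + (d ^ (t % P))
  weight-orbit {x} t Tt≈x with inOrbit? x
  ... | yes (t' , Tt'≈x) = cong (λ z → + (d ^ z)) (≈⇒≡% {t'} {t} (trans Tt'≈x (sym Tt≈x)))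
  ... | no ¬orbit        = contradiction (t , Tt≈x) ¬orbit

  weight-off : ∀ {x} → ¬ SameOrbit M d r x → weight x ≡ + 0
  weight-off {x} ¬orbit with inOrbit? x
  ... | yes orbit = contradiction orbit ¬orbit
  ... | no _      = refl

  weight-resp : ∀ {x y} → x ≈ y → weight x ≡ weight y
  weight-resp {x} {y} x≈y = case inOrbit? x of λ
    { (yes (t , Tt≈x)) → trans (weight-orbit t Tt≈x) (sym (weight-orbit t (trans Tt≈x x≈y)))
    ; (no ¬orbit)      → trans (weight-off ¬orbit)
                               (sym (weight-off λ (t , Tt≈y) → ¬orbit (t , trans Tt≈y (sym x≈y)))) }

  -- The modulus d^P - 1 of the cyclic summand attached to the orbit.
  N : ℤ
  N = + (d ^ P) - + 1

  weight-self : weight r ≡ + 1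
  weight-self = weight-orbit 0 (cong (_% M) T-0)

  weight-zero : ¬ r ≈ 0 → weight 0 ≡ + 0
  weight-zero r≉0 = weight-off λ (t , Tt≈0) →
    r≉0 (cancel-pow t (trans Tt≈0 (cong (_% M) (sym (ℕP.*-zeroʳ (d ^ t))))))

  weight-step : ∀ v → N ∣ (+ d * weight v - weight (d ℕ.* v))
  weight-step v = case inOrbit? v of λ
    { (yes (t , Tt≈v)) → on-orbit t Tt≈v
    ; (no ¬orbit)      → off-orbit ¬orbit }
    where
    on-orbit : ∀ t → T t ≈ v → N ∣ (+ d * weight v - weight (d ℕ.* v))
    on-orbit t Tt≈v = subst (N ∣_) (sym expand)
      (pow-congruence d P (suc (t % P)) (suc t % P) (trans exponents (sym (m%n%n≡m%n (suc t) P))))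
      where
      open ≡-Reasoning
      dTt≈dv : T (suc t) ≈ d ℕ.* v
      dTt≈dv = trans (cong (_% M) (T-suc t)) (≈-mulˡ d {T t} {v} Tt≈v)
      expand : + d * weight v - weight (d ℕ.* v) ≡ + (d ^ suc (t % P)) - + (d ^ (suc t % P))
      expand = cong₂ _-_ (trans (cong (λ z → + d * z) (weight-orbit t Tt≈v)) (sym (ℤP.pos-* d (d ^ (t % P)))))
                         (weight-orbit (suc t) dTt≈dv)
      exponents : suc (t % P) % P ≡ suc t % P
      exponents = begin
        suc (t % P) % P                   ≡⟨ [m+kn]%n≡m%n (suc (t % P)) (t / P) P ⟨
        suc (t % P ℕ.+ t / P ℕ.* P) % P   ≡⟨ cong (λ z → suc z % P) (m≡m%n+[m/n]*n t P) ⟨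
        suc t % P                         ∎
    -- off the orbit, d v is off the orbit too: d T(P-1+t) ≡ T(P+t) ≡ T t
    dv-off : ¬ SameOrbit M d r v → ¬ SameOrbit M d r (d ℕ.* v)
    dv-off ¬orbit (t , Tt≈dv) = ¬orbit (proj₁ firstReturn ℕ.+ t , cancel (begin
      (d ℕ.* T (proj₁ firstReturn ℕ.+ t)) % M   ≡⟨ cong (_% M) (T-suc (proj₁ firstReturn ℕ.+ t)) ⟨
      T (P ℕ.+ t) % M                           ≡⟨ ≡%⇒≈ {P ℕ.+ t} {t} P+t≡t ⟩
      T t % M                                   ≡⟨ Tt≈dv ⟩
      (d ℕ.* v) % M                             ∎))
      where
      open ≡-Reasoning
      P+t≡t : (P ℕ.+ t) % P ≡ t % P
      P+t≡t = trans (cong (_% P) (ℕP.+-comm P t)) ([m+n]%n≡m%n t P)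
    off-orbit : ¬ SameOrbit M d r v → N ∣ (+ d * weight v - weight (d ℕ.* v))
    off-orbit ¬orbit = subst (N ∣_) (sym vanish) (divides (+ 0) (sym (ℤP.*-zeroˡ N)))
      where
      vanish : + d * weight v - weight (d ℕ.* v) ≡ + 0
      vanish = trans (cong₂ (λ a b → + d * a - b) (weight-off ¬orbit) (weight-off (dv-off ¬orbit)))
                     (cong (_- + 0) (ℤP.*-zeroʳ (+ d)))

  modulus≡N : .{{_ : NonZero d}} → + (d ^ orbitSize M d r ℕ.∸ 1) ≡ N
  modulus≡N = trans (cong (λ o → + (d ^ o ℕ.∸ 1)) orbitSize≡P)
                    (sym (trans (ℤP.m-n≡m⊖n (d ^ P) 1) (ℤP.⊖-≥ (ℕP.m^n>0 d P))))

module Isomorphism (m' d : ℕ) .{{_ : NonZero d}} (cop : Coprime (suc m') d)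
                   (k : ℕ) (rep : Fin k → ℕ) (transversal : IsTransversal (suc m') d k rep) where

  open Congruence m'
  open Polynomials m'
  module O (i : Fin k) = Orbit m' d cop (rep i)

  private
    M : ℕ
    M = suc m'

  ℰ : Poly M → Set
  ℰ = Inℰ M d

  rep-nonzero : ∀ i → ¬ rep i ≈ 0
  rep-nonzero i rep≈0 = ℕP.<⇒≢ (proj₁ (proj₁ transversal i))
    (sym (trans (sym (m<n⇒m%n≡m (proj₂ (proj₁ transversal i)))) rep≈0))

  separated : ∀ i i' → SameOrbit M d (rep i) (rep i') → i ≡ i'
  separated = proj₁ (proj₂ transversal)

  common-orbit : ∀ {i i' v} → SameOrbit M d (rep i) v → SameOrbit M d (rep i') v → i ≡ i'
  common-orbit {i} {i'} {v} (t , Tt≈v) (t' , T't'≈v) with O.orbit-back i' {v} t' T't'≈v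
  ... | k' , back = separated i i' (k' ℕ.+ t ,
        trans (cong (_% M) (O.T-add i k' t)) (trans (≈-mulˡ (d ^ k') {O.T i t} {v} Tt≈v) back))

  W : Fin k → Fin M → ℤ
  W i j = O.weight i (toℕ j)

  φ : Poly M → Fin k → ℤ
  φ p i = ⟨ p , W i ⟩

  -- φ(e_v)_i = weight_i(v), since weight_i(0) = 0.
  φ-e : ∀ v i → φ (e M v) i ≡ O.weight i v
  φ-e v i = begin
    φ (e M v) i                    ≡⟨ pair-e v (W i) ⟩
    W i (idx M v) - W i (idx M 0)  ≡⟨ cong₂ _-_ weight-v (O.weight-zero i (rep-nonzero i)) ⟩
    O.weight i v - + 0             ≡⟨ ℤP.+-identityʳ (O.weight i v) ⟩
    O.weight i v                   ∎
    where
    open ≡-Reasoning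
    weight-v : W i (idx M v) ≡ O.weight i v
    weight-v = trans (cong (O.weight i) (FinP.toℕ-fromℕ< (m%n<n v M))) (O.weight-resp i (m%n%n≡m%n v M))

  φ-ε : ∀ v i → O.N i ∣ φ (ε M d v) i
  φ-ε v i = subst (O.N i ∣_) (sym expand) (O.weight-step i v)
    where
    expand : φ (ε M d v) i ≡ + d * O.weight i v - O.weight i (d ℕ.* v)
    expand = trans (pair-sub (λ j → + d * e M v j) (e M (d ℕ.* v)) (W i))
      (cong₂ _-_ (trans (pair-scale (+ d) (e M v) (W i)) (cong (λ z → + d * z) (φ-e v i)))
                 (φ-e (d ℕ.* v) i))

  ε-resp : ∀ {x y} → x ≈ y → ε M d x ≗ ε M d y
  ε-resp {x} {y} x≈y j =
    cong₂ (λ a b → + d * a - b) (e-resp {x} {y} x≈y j) (e-resp {d ℕ.* x} {d ℕ.* y} (≈-mulˡ d {x} {y} x≈y) j)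

  -- Every ε_w (w arbitrary) lies in ℰ: ε_w = ε_{w mod M}, and ε_0 = 0.
  ε-gen : ∀ w → ℰ (ε M d w)
  ε-gen w = span-resp (ε M d) (ε-resp (m%n%n≡m%n w M)) (by-residue (w % M) (m%n<n w M))
    where
    ε-0 : ∀ j → ε M d 0 j ≡ + 0
    ε-0 j = trans (cong₂ (λ a b → + d * a - b) (e-0 j) (trans (e-resp {d ℕ.* 0} {0} (cong (_% M) (ℕP.*-zeroʳ d)) j) (e-0 j)))
                  (cong (_- + 0) (ℤP.*-zeroʳ (+ d)))
    by-residue : ∀ u → u < M → ℰ (ε M d u)
    by-residue zero    _   = span-resp (ε M d) (λ j → sym (ε-0 j)) (span-zero (ε M d))
    by-residue (suc u) u<M = span-gen (ε M d) (suc u) (s≤s z≤n) u<M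

  -- d^n e_x - e_{d^n x} = Σ_{s<n} d^(n-1-s) ε_{d^s x} lies in ℰ.
  telescope : ∀ x n → ℰ (λ j → + (d ^ n) * e M x j - e M (d ^ n ℕ.* x) j)
  telescope x zero = span-resp (ε M d) (λ j → sym (vanish j)) (span-zero (ε M d))
    where
    vanish : ∀ j → + 1 * e M x j - e M (1 ℕ.* x) j ≡ + 0
    vanish j rewrite ℕP.*-identityˡ x | ℤP.*-identityˡ (e M x j) = ℤP.i≡j⇒i-j≡0 {e M x j} refl
  telescope x (suc n) = span-resp (ε M d) step
    (span-+ (ε M d) (span-scale (ε M d) (+ d) (telescope x n)) (ε-gen (d ^ n ℕ.* x)))
    where
    regroup : ∀ a b y z w → a * (b * y - z) + (a * z - w) ≡ a * b * y - w
    regroup = solve-∀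
    step : ∀ j → + d * (+ (d ^ n) * e M x j - e M (d ^ n ℕ.* x) j) + ε M d (d ^ n ℕ.* x) j
               ≡ + (d ^ suc n) * e M x j - e M (d ^ suc n ℕ.* x) j
    step j = trans (regroup (+ d) (+ (d ^ n)) (e M x j) (e M (d ^ n ℕ.* x) j) (e M (d ℕ.* (d ^ n ℕ.* x)) j))
                   (cong₂ (λ a y → a * e M x j - e M y j) (sym (ℤP.pos-* d (d ^ n))) (sym (ℕP.*-assoc d (d ^ n) x)))

  -- N_i e_{rep i} ∈ ℰ, because d^P rep i ≡ rep i (mod M).
  cycle-relation : ∀ i → ℰ (λ j → O.N i * e M (rep i) j)
  cycle-relation i = span-resp (ε M d) collapse (telescope (rep i) (O.P i))
    where
    returns : d ^ O.P i ℕ.* rep i ≈ rep i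
    returns = trans (O.P-returns i) (cong (_% M) (O.T-0 i))
    factor : ∀ a y → a * y - y ≡ (a - + 1) * y
    factor = solve-∀
    collapse : ∀ j → + (d ^ O.P i) * e M (rep i) j - e M (d ^ O.P i ℕ.* rep i) j ≡ O.N i * e M (rep i) j
    collapse j = trans (cong (λ z → + (d ^ O.P i) * e M (rep i) j - z) (e-resp {d ^ O.P i ℕ.* rep i} {rep i} returns j))
                       (factor (+ (d ^ O.P i)) (e M (rep i) j))

  multiples-in-ℰ : ∀ (a : Fin k → ℤ) → (∀ i → O.N i ∣ a i) → ℰ (λ j → ∑[ i < k ] (a i * e M (rep i) j))
  multiples-in-ℰ a N∣a = span-resp (ε M d) (λ j → sum-cong-≗ (λ i → regroup i j))
    (span-lincomb (ε M d) quot (λ i j → O.N i * e M (rep i) j) cycle-relation)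
    where
    quot : Fin k → ℤ
    quot i = _∣_.quotient (N∣a i)
    regroup : ∀ i j → quot i * (O.N i * e M (rep i) j) ≡ a i * e M (rep i) j
    regroup i j = trans (sym (ℤP.*-assoc (quot i) (O.N i) (e M (rep i) j)))
                        (cong (_* e M (rep i) j) (sym (_∣_.equality (N∣a i))))

  -- Each generator e_v (0 < v < M) is congruent modulo ℰ to
  -- Σ_i weight_i(v) e_{rep i} = d^(t mod P) e_{rep i₀}, where v ≡ d^t rep i₀.
  generator-reduction : ∀ v → 0 < v → v < M →
                        ℰ (λ j → e M v j - ∑[ i < k ] (O.weight i v * e M (rep i) j))
  generator-reduction v 0<v v<M with proj₂ (proj₂ transversal) v 0<v v<M
  ... | i₀ , (t , Tt≈v) = span-resp (ε M d) rewrite-as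
    (span-sub (ε M d) (span-zero (ε M d)) (telescope (rep i₀) s))
    where
    s = t % O.P i₀
    lands : d ^ s ℕ.* rep i₀ ≈ v
    lands = trans (sym (O.reduce i₀ t)) Tt≈v
    off : ∀ j i → i ≢ i₀ → O.weight i v * e M (rep i) j ≡ + 0
    off j i i≢i₀ = trans (cong (_* e M (rep i) j) (O.weight-off i (λ orbit → i≢i₀ (common-orbit {i} {i₀} {v} orbit (t , Tt≈v)))))
                         (ℤP.*-zeroˡ (e M (rep i) j))
    collapse : ∀ j → ∑[ i < k ] (O.weight i v * e M (rep i) j) ≡ + (d ^ s) * e M (rep i₀) j
    collapse j = trans (sum-single _ i₀ (off j)) (cong (_* e M (rep i₀) j) (O.weight-orbit i₀ t Tt≈v))
    negate : ∀ a y z → + 0 - (a * y - z) ≡ z - a * y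
    negate = solve-∀
    rewrite-as : ∀ j → + 0 - (+ (d ^ s) * e M (rep i₀) j - e M (d ^ s ℕ.* rep i₀) j)
                       ≡ e M v j - ∑[ i < k ] (O.weight i v * e M (rep i) j)
    rewrite-as j = trans (negate (+ (d ^ s)) (e M (rep i₀) j) (e M (d ^ s ℕ.* rep i₀) j))
                         (cong₂ _-_ (e-resp {d ^ s ℕ.* rep i₀} {v} lands j) (sym (collapse j)))

  ν : Poly M → Poly M
  ν p j = ∑[ i < k ] (φ p i * e M (rep i) j)

  -- Every p ∈ 𝒵_m is congruent to its normal form modulo ℰ: writing
  -- p = Σ_v c_v e_v, p - ν p = Σ_v c_v (e_v - ν e_v).
  reduction : ∀ {p} → In𝒵 M p → ℰ (λ j → p j - ν p j)
  reduction {p} zp = span-resp (ε M d) (λ j → rewrite-as j)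
    (span-lincomb (ε M d) c R (λ v → generator-reduction (suc (toℕ v)) (s≤s z≤n) (s≤s (FinP.toℕ<n v))))
    where
    open ≡-Reasoning
    c : Fin m' → ℤ
    c v = proj₁ zp (suc (toℕ v))
    G : Fin m' → Poly M
    G v j = ∑[ i < k ] (O.weight i (suc (toℕ v)) * e M (rep i) j)
    R : Fin m' → Poly M
    R v j = e M (suc (toℕ v)) j - G v j
    φ-p : ∀ i → φ p i ≡ ∑[ v < m' ] (c v * O.weight i (suc (toℕ v)))
    φ-p i = trans (pair-resp (W i) (span-elim (e M) zp))
                  (trans (sum-lincomb c (λ v → e M (suc (toℕ v))) (W i))
                         (sum-cong-≗ (λ v → cong (c v *_) (φ-e (suc (toℕ v)) i))))
    distrib : ∀ a x y → a * (x - y) ≡ a * x - a * y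
    distrib = solve-∀
    rewrite-as : ∀ j → ∑[ v < m' ] (c v * R v j) ≡ p j - ν p j
    rewrite-as j = begin
      ∑[ v < m' ] (c v * R v j)
        ≡⟨ sum-cong-≗ (λ v → distrib (c v) (e M (suc (toℕ v)) j) (G v j)) ⟩
      ∑[ v < m' ] (c v * e M (suc (toℕ v)) j - c v * G v j)
        ≡⟨ ∑-sub (λ v → c v * e M (suc (toℕ v)) j) (λ v → c v * G v j) ⟩
      ∑[ v < m' ] (c v * e M (suc (toℕ v)) j) - ∑[ v < m' ] (c v * G v j)
        ≡⟨ cong₂ _-_ (sym (span-elim (e M) zp j))
                     (sym (sum-lincomb c (λ v i → O.weight i (suc (toℕ v))) (λ i → e M (rep i) j))) ⟩
      p j - ∑[ i < k ] (∑[ v < m' ] (c v * O.weight i (suc (toℕ v))) * e M (rep i) j)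
        ≡⟨ cong (λ z → p j - z) (sum-cong-≗ (λ i → cong (_* e M (rep i) j) (sym (φ-p i)))) ⟩
      p j - ν p j
        ∎

  ≈ₜ-intro : ∀ {t t'} → (∀ i → O.N i ∣ (t i - t' i)) → _≈ₜ_ M d k rep t t'
  ≈ₜ-intro {t} {t'} N∣ i = subst (λ n → n ∣ᵤ (t i - t' i)) (sym (O.modulus≡N i)) (∣⇒∣ᵤ (N∣ i))

  ≈ₜ-elim : ∀ {t t'} → _≈ₜ_ M d k rep t t' → ∀ i → O.N i ∣ (t i - t' i)
  ≈ₜ-elim {t} {t'} t≈t' i = ∣ᵤ⇒∣ (subst (λ n → n ∣ᵤ (t i - t' i)) (O.modulus≡N i) (t≈t' i))

  ≈ₜ-reflexive : ∀ {t t'} → (∀ i → t i ≡ t' i) → _≈ₜ_ M d k rep t t'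
  ≈ₜ-reflexive {t} {t'} t≡t' = ≈ₜ-intro {t} {t'} λ i → divides (+ 0) (ℤP.i≡j⇒i-j≡0 (t≡t' i))

  φ-additive : ∀ p q → _≈ₜ_ M d k rep (φ (_+ₚ_ M p q)) (λ i → φ p i + φ q i)
  φ-additive p q = ≈ₜ-reflexive {φ (_+ₚ_ M p q)} {λ i → φ p i + φ q i} (λ i → pair-+ p q (W i))

  -- φ is constant on classes modulo ℰ, since it kills every ε_v.
  φ-respects-ℰ : ∀ p q → ℰ (_-ₚ_ M p q) → _≈ₜ_ M d k rep (φ p) (φ q)
  φ-respects-ℰ p q p-q∈ℰ = ≈ₜ-intro {φ p} {φ q} λ i →
    subst (O.N i ∣_) (expand i) (∣-sum _ (λ v → ∣n⇒∣m*n (c v) (φ-ε (suc (toℕ v)) i)))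
    where
    c : Fin m' → ℤ
    c v = proj₁ p-q∈ℰ (suc (toℕ v))
    expand : ∀ i → ∑[ v < m' ] (c v * φ (ε M d (suc (toℕ v))) i) ≡ φ p i - φ q i
    expand i = sym (trans (sym (pair-sub p q (W i)))
                          (trans (pair-resp (W i) (span-elim (ε M d) p-q∈ℰ))
                                 (sum-lincomb c (λ v → ε M d (suc (toℕ v))) (W i))))

  -- If φ p ≡ φ q then p - q is congruent to its normal form ν(p - q),
  -- a combination of the N_i e_{rep i}; hence p - q ∈ ℰ.
  φ-injective : ∀ p q → In𝒵 M p → In𝒵 M q → _≈ₜ_ M d k rep (φ p) (φ q) → ℰ (_-ₚ_ M p q)
  φ-injective p q zp zq φp≈φq =
    span-resp (ε M d) (λ j → cancel (u j) (ν u j)) (span-+ (ε M d) (reduction zu) νu∈ℰ)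
    where
    u : Poly M
    u = _-ₚ_ M p q
    zu : In𝒵 M u
    zu = span-sub (e M) zp zq
    νu∈ℰ : ℰ (ν u)
    νu∈ℰ = span-resp (ε M d) (λ j → sum-cong-≗ (λ i → cong (_* e M (rep i) j) (sym (pair-sub p q (W i)))))
                     (multiples-in-ℰ (λ i → φ p i - φ q i) (≈ₜ-elim {φ p} {φ q} φp≈φq))
    cancel : ∀ x y → x - y + y ≡ x
    cancel = solve-∀

  -- φ(Σ_i t_i e_{rep i}) = t, because weight_{i'}(rep i) is 1 for i = i' and 0 otherwise.
  φ-surjective : ∀ t → ∃ λ p → In𝒵 M p × _≈ₜ_ M d k rep (φ p) t
  φ-surjective t = p , span-lincomb (e M) t (λ i → e M (rep i)) rep∈𝒵 , ≈ₜ-reflexive {φ p} {t} φ-p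
    where
    p : Poly M
    p j = ∑[ i < k ] (t i * e M (rep i) j)
    rep∈𝒵 : ∀ i → In𝒵 M (e M (rep i))
    rep∈𝒵 i = span-gen (e M) (rep i) (proj₁ (proj₁ transversal i)) (proj₂ (proj₁ transversal i))
    off : ∀ i' i → i ≢ i' → t i * O.weight i' (rep i) ≡ + 0
    off i' i i≢i' = trans (cong (t i *_) (O.weight-off i' (λ orbit → i≢i' (sym (separated i' i orbit)))))
                          (ℤP.*-zeroʳ (t i))
    φ-p : ∀ i' → φ p i' ≡ t i'
    φ-p i' = begin
      φ p i'                                         ≡⟨ sum-lincomb t (λ i → e M (rep i)) (W i') ⟩
      ∑[ i < k ] (t i * φ (e M (rep i)) i')          ≡⟨ sum-cong-≗ (λ i → cong (t i *_) (φ-e (rep i) i')) ⟩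
      ∑[ i < k ] (t i * O.weight i' (rep i))         ≡⟨ sum-single _ i' (off i') ⟩
      t i' * O.weight i' (rep i')                    ≡⟨ cong (t i' *_) (O.weight-self i') ⟩
      t i' * + 1                                     ≡⟨ ℤP.*-identityʳ (t i') ⟩
      t i'                                           ∎
      where open ≡-Reasoning

theorem5p1 : (m d : ℕ) → {{_ : NonZero m}} → 2 ≤ d → Coprime m d →
    (k : ℕ) (rep : Fin k → ℕ) → IsTransversal m d k rep →
    Σ (Poly m → Fin k → ℤ) (IsIso m d k rep)
theorem5p1 (suc m') d 2≤d cop k rep transversal =
    φ
  , (λ p q _ _ → φ-additive p q)
  , (λ p q _ _ → φ-respects-ℰ p q)
  , φ-injective
  , φ-surjective
  where
  open Isomorphism m' d {{ℕ.>-nonZero (ℕP.≤-trans (s≤s z≤n) 2≤d)}} cop k rep transversal
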